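{- For every partition $\pi\in\mathcal P_n^k$, $$\mathrm{mak}(\pi)=\mathrm{lmak}'(\pi)=\mathrm{los}(\pi)-\mathrm{rinv}(\mathcal F,\pi)+\mathrm{linv}(\mathcal O,\pi),$$ $$\mathrm{mak}'(\pi)=\mathrm{lmak}(\pi)=n(k-1)-\mathrm{los}(\pi)-\mathrm{linv}(\mathcal F,\pi).$$
   Context: $\mathcal P_n^k$ denotes the set of set partitions of $[n]$ into $k$ blocks, written $\pi=B_1-\cdots-B_k$ with the blocks listed in increasing order of their smallest elements. Let $w_i$ be the index of the block containing $i$. The openers $\mathcal O=\mathcal O(\pi)$ are the smallest elements of the blocks, and the closers $\mathcal F=\mathcal F(\pi)$ are their largest elements. For $i\in[n]$ define: $\mathrm{ros}_i=\#\{j\in\mathcal O: j<i,\ w_j>w_i\}$, $\mathrm{rob}_i=\#\{j\in\mathcal O: j>i,\ w_j>w_i\}$, $\mathrm{rcs}_i=\#\{j\in\mathcal F: j<i,\ w_j>w_i\}$, $\mathrm{rcb}_i=\#\{j\in\mathcal F: j>i,\ w_j>w_i\}$, $\mathrm{los}_i=\#\{j\in\mathcal O: j<i,\ w_j<w_i\}$, $\mathrm{lob}_i=\#\{j\in\mathcal O: j>i,\ w_j<w_i\}$, $\mathrm{lcs}_i=\#\{j\in\mathcal F: j<i,\ w_j<w_i\}$, $\mathrm{lcb}_i=\#\{j\in\mathcal F: j>i,\ w_j<w_i\}$. Each statistic is the sum of its coordinates. Set $\mathrm{mak}=\mathrm{ros}+\mathrm{lcs}$, $\mathrm{mak}'=\mathrm{lob}+\mathrm{rcb}$,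 $\mathrm{lmak}'=n(k-1)-(\mathrm{lcb}+\mathrm{rob})$ and $\mathrm{lmak}=n(k-1)-(\mathrm{los}+\mathrm{rcs})$. For $b\in B_j$ and $i>j$ let $\mathrm{rinv}(b,B_i)=\#\{a\in B_i: a<b\}$. For $i<j$ let $\mathrm{linv}(b,B_i)=\#\{a\in B_i: a>b\}$. Then $\mathrm{rinv}(b,\pi)=\sum_{i>j}\mathrm{rinv}(b,B_i)$ and $\mathrm{linv}(b,\pi)=\sum_{i<j}\mathrm{linv}(b,B_i)$. Finally $\mathrm{linv}(\mathcal O,\pi)=\sum_{b\in\mathcal O}\mathrm{linv}(b,\pi)$, $\mathrm{linv}(\mathcal F,\pi)=\sum_{b\in\mathcal F}\mathrm{linv}(b,\pi)$ and $\mathrm{rinv}(\mathcal F,\pi)=\sum_{b\in\mathcal F}\mathrm{rinv}(b,\pi)$. -}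

module Defs where

open import Data.Nat using (ℕ; _+_; _*_; _∸_)
open import Data.Fin using (Fin; toℕ) renaming (_<_ to _<ᶠ_; _<?_ to _<ᶠ?_; _≟_ to _≟ᶠ_)
open import Data.List using (List; map; allFin)
open import Data.Nat.ListAction using (sum)
open import Data.Bool.ListAction using (all)
open import Data.Bool using (Bool; if_then_else_; _∧_; not)
open import Data.Product using (Σ; ∃; _×_; _,_)
open import Relation.Nullary using (¬_; Dec)
open import Relation.Nullary.Decidable using (⌊_⌋)
open import Relation.Binary.PropositionalEquality using (_≡_)
open import Data.Integer as ℤ using (ℤ)

∑ : (n : ℕ) → (Fin n → ℕ) → ℕ
∑ n f = sum (map f (allFin n))

count : (n : ℕ) → (Fin n → Bool) → ℕ
count n p = ∑ n (λ i → if p i then 1 else 0)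

-- A set partition of [n] = {0,…,n-1} into k blocks B_0 - … - B_{k-1}
-- (blocks listed in increasing order of their smallest elements),
-- given by w : element ↦ index of its block.
record SetPartition (n k : ℕ) : Set where
  field
    w : Fin n → Fin k
    nonempty : ∀ (b : Fin k) → ∃ λ i → w i ≡ b
    ordered  : ∀ (i : Fin n) (b : Fin k) → b <ᶠ w i → ∃ λ j → (j <ᶠ i) × (w j ≡ b)
open SetPartition public

module _ {n k : ℕ} (π : SetPartition n k) where
  private
    W = w π
    _<ᵇ_ : ∀ {m} → Fin m → Fin m → Bool
    a <ᵇ b = ⌊ a <ᶠ? b ⌋
    _≡ᵇ_ : ∀ {m} → Fin m → Fin m → Bool
    a ≡ᵇ b = ⌊ a ≟ᶠ b ⌋

  isOpener : Fin n → Bool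
  isOpener j = all (λ i → not ((i <ᵇ j) ∧ (W i ≡ᵇ W j))) (allFin n)

  isCloser : Fin n → Bool
  isCloser j = all (λ i → not ((j <ᵇ i) ∧ (W i ≡ᵇ W j))) (allFin n)

  ros-at rob-at rcs-at rcb-at los-at lob-at lcs-at lcb-at : Fin n → ℕ
  ros-at i = count n (λ j → isOpener j ∧ (j <ᵇ i) ∧ (W i <ᵇ W j))
  rob-at i = count n (λ j → isOpener j ∧ (i <ᵇ j) ∧ (W i <ᵇ W j))
  rcs-at i = count n (λ j → isCloser j ∧ (j <ᵇ i) ∧ (W i <ᵇ W j))
  rcb-at i = count n (λ j → isCloser j ∧ (i <ᵇ j) ∧ (W i <ᵇ W j))
  los-at i = count n (λ j → isOpener j ∧ (j <ᵇ i) ∧ (W j <ᵇ W i))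
  lob-at i = count n (λ j → isOpener j ∧ (i <ᵇ j) ∧ (W j <ᵇ W i))
  lcs-at i = count n (λ j → isCloser j ∧ (j <ᵇ i) ∧ (W j <ᵇ W i))
  lcb-at i = count n (λ j → isCloser j ∧ (i <ᵇ j) ∧ (W j <ᵇ W i))

  ros rob rcs rcb los lob lcs lcb : ℕ
  ros = ∑ n ros-at
  rob = ∑ n rob-at
  rcs = ∑ n rcs-at
  rcb = ∑ n rcb-at
  los = ∑ n los-at
  lob = ∑ n lob-at
  lcs = ∑ n lcs-at
  lcb = ∑ n lcb-at

  nk-1 : ℤ
  nk-1 = ℤ.+ (n * (k ∸ 1))

  mak mak' lmak lmak' : ℤ
  mak   = ℤ.+ (ros + lcs)
  mak'  = ℤ.+ (lob + rcb)
  lmak' = nk-1 ℤ.- ℤ.+ (lcb + rob)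
  lmak  = nk-1 ℤ.- ℤ.+ (los + rcs)

  rinvB linvB : Fin n → Fin k → ℕ
  rinvB b i = count n (λ a → (W a ≡ᵇ i) ∧ (a <ᵇ b))
  linvB b i = count n (λ a → (W a ≡ᵇ i) ∧ (b <ᵇ a))

  rinv linv : Fin n → ℕ
  rinv b = ∑ k (λ i → if W b <ᵇ i then rinvB b i else 0)
  linv b = ∑ k (λ i → if i <ᵇ W b then linvB b i else 0)

  linv-O linv-F rinv-F : ℕ
  linv-O = ∑ n (λ b → if isOpener b then linv b else 0)
  linv-F = ∑ n (λ b → if isCloser b then linv b else 0)
  rinv-F = ∑ n (λ b → if isCloser b then rinv b else 0)

module Submission where

-- Every block has exactly one opener and exactly one closer. So for a fixed i, the
-- openers of the blocks above w_i split by position into ros_i + rob_i, and the closers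
-- of the blocks below w_i into lcs_i + lcb_i; together they count the k − 1 other
-- blocks, whence ros + rob + lcs + lcb = n(k − 1), and symmetrically
-- rcs + rcb + los + lob = n(k − 1). Exchanging the order of summation identifies
-- linv(O) = ros, linv(F) = rcs and rinv(F) = lcb. Finally, the opener of a smaller block
-- precedes every element of a larger one, so lob = 0 and los = lcs + lcb.

open import Defs
open import Data.Nat using (ℕ; zero; suc; _*_; _∸_)
import Data.Nat as ℕ
import Data.Nat.Properties as ℕₚ
open import Data.Nat.ListAction using (sum)
open import Data.Nat.Tactic.RingSolver using (solve-∀)
open import Data.Bool using (Bool; true; false; T; not; _∧_; if_then_else_)
open import Data.Bool.Properties using (T-∧; T-≡; T-not-≡; if-∧; if-eta; ∧-comm; ∧-zeroʳ; ∧-identityʳ)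
open import Data.Bool.ListAction using (all)
open import Data.Fin using (Fin; zero; suc; punchIn; _<_)
open import Data.Fin.Properties using (_≟_; _<?_; <-cmp; <-asym; <-irrefl; any?; punchInᵢ≢i)
open import Data.Fin.Induction using (<-wellFounded; >-wellFounded)
open import Data.List using (map; allFin; tabulate)
open import Data.List.Properties using (map-cong; map-tabulate)
open import Data.List.Relation.Unary.All.Properties using (all⁺; all⁻; tabulate⁺; tabulate⁻)
open import Data.Product using (∃; _×_; _,_; proj₂)
open import Function using (_∘_; id; _⇔_; mk⇔; Equivalence)
open import Induction.WellFounded using (WellFounded; Acc; acc)
open import Relation.Nullary using (Dec; yes; no; ¬_; contradiction)
open import Relation.Nullary.Decidable using (⌊_⌋; _×-dec_; toWitness; fromWitness; fromWitnessFalse)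
open import Relation.Unary using (Pred)
import Relation.Unary as U
open import Relation.Binary using (Rel; Trichotomous; tri<; tri≈; tri>)
import Relation.Binary as B
import Relation.Binary.Construct.Flip.EqAndOrd as Flip
open import Relation.Binary.PropositionalEquality
  using (_≡_; _≢_; _≗_; refl; sym; trans; cong; cong₂; module ≡-Reasoning)
import Algebra.Properties.CommutativeMonoid.Sum ℕₚ.+-0-commutativeMonoid as ℕΣ

open ≡-Reasoning

-- ℕ addition is opened only inside this module: outside it, _+_ is integer addition.
module Counting where

  open import Data.Nat using (_+_)

  ∑≡sum : ∀ {n} (f : Fin n → ℕ) → ∑ n f ≡ ℕΣ.sum f
  ∑≡sum {zero}  f = refl
  ∑≡sum {suc n} f = cong (f zero +_) (begin
    sum (map f (tabulate suc))  ≡⟨ cong sum (map-tabulate suc f) ⟩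
    sum (tabulate (f ∘ suc))    ≡⟨ cong sum (map-tabulate id (f ∘ suc)) ⟨
    ∑ n (f ∘ suc)               ≡⟨ ∑≡sum (f ∘ suc) ⟩
    ℕΣ.sum (f ∘ suc)            ∎)

  ∑-cong : ∀ n {f g : Fin n → ℕ} → f ≗ g → ∑ n f ≡ ∑ n g
  ∑-cong n {f} {g} f≗g = cong sum (map-cong {f = f} {g} f≗g (allFin n))

  ∑-distrib-+ : ∀ {n} (f g : Fin n → ℕ) → ∑ n (λ i → f i + g i) ≡ ∑ n f + ∑ n g
  ∑-distrib-+ {n} f g = begin
    ∑ n (λ i → f i + g i)         ≡⟨ ∑≡sum {n} (λ i → f i + g i) ⟩
    ℕΣ.sum {n} (λ i → f i + g i)  ≡⟨ ℕΣ.∑-distrib-+ f g ⟩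
    ℕΣ.sum f + ℕΣ.sum g           ≡⟨ cong₂ _+_ (∑≡sum f) (∑≡sum g) ⟨
    ∑ n f + ∑ n g                 ∎

  ∑-comm : ∀ {m n} (f : Fin m → Fin n → ℕ) → ∑ m (λ i → ∑ n (f i)) ≡ ∑ n (λ j → ∑ m (λ i → f i j))
  ∑-comm {m} {n} f = begin
    ∑ m (λ i → ∑ n (f i))                    ≡⟨ trans (∑-cong m (λ i → ∑≡sum (f i))) (∑≡sum {m} _) ⟩
    ℕΣ.sum {m} (λ i → ℕΣ.sum (f i))          ≡⟨ ℕΣ.∑-comm f ⟩
    ℕΣ.sum {n} (λ j → ℕΣ.sum (λ i → f i j))  ≡⟨ trans (∑-cong n (λ j → ∑≡sum {m} _)) (∑≡sum {n} _) ⟨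
    ∑ n (λ j → ∑ m (λ i → f i j))            ∎

  ∑-const : ∀ n c → ∑ n (λ _ → c) ≡ n * c
  ∑-const n c = trans (∑≡sum {n} (λ _ → c)) (sum-const n)
    where
    sum-const : ∀ n → ℕΣ.sum {n} (λ _ → c) ≡ n * c
    sum-const zero    = refl
    sum-const (suc n) = cong (c +_) (sum-const n)

  ∑-single : ∀ {n} (f : Fin n → ℕ) (a : Fin n) → (∀ i → i ≢ a → f i ≡ 0) → ∑ n f ≡ f a
  ∑-single {suc n} f a vanishes = begin
    ∑ (suc n) f                   ≡⟨ ∑≡sum f ⟩
    ℕΣ.sum f                      ≡⟨ ℕΣ.sum-remove {i = a} f ⟩
    f a + ℕΣ.sum (f ∘ punchIn a)  ≡⟨ cong (f a +_) (ℕΣ.sum-cong-≗ (λ j → vanishes _ (punchInᵢ≢i a j))) ⟩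
    f a + ℕΣ.sum {n} (λ _ → 0)    ≡⟨ cong (f a +_) (ℕΣ.sum-replicate-zero n) ⟩
    f a + 0                       ≡⟨ ℕₚ.+-identityʳ (f a) ⟩
    f a                           ∎

  ∑-distrib-+₄ : ∀ {n} (f g h l : Fin n → ℕ) →
    ∑ n (λ i → (f i + g i) + (h i + l i)) ≡ (∑ n f + ∑ n g) + (∑ n h + ∑ n l)
  ∑-distrib-+₄ f g h l =
    trans (∑-distrib-+ (λ i → f i + g i) (λ i → h i + l i)) (cong₂ _+_ (∑-distrib-+ f g) (∑-distrib-+ h l))

  if-∑ : ∀ b n (f : Fin n → ℕ) → (if b then ∑ n f else 0) ≡ ∑ n (λ i → if b then f i else 0)
  if-∑ true  n f = refl
  if-∑ false n f = sym (trans (∑-const n 0) (ℕₚ.*-zeroʳ n))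

  𝟙 : Bool → ℕ
  𝟙 b = if b then 1 else 0

  𝟙-true : ∀ {b} → T b → 𝟙 b ≡ 1
  𝟙-true {true} _ = refl

  𝟙-false : ∀ {b} → ¬ T b → 𝟙 b ≡ 0
  𝟙-false {true}  ¬t = contradiction _ ¬t
  𝟙-false {false} _  = refl

  count-none : ∀ {n} {p : Fin n → Bool} → (∀ i → ¬ T (p i)) → count n p ≡ 0
  count-none {n} ¬p = trans (∑-cong n (λ i → 𝟙-false (¬p i))) (trans (∑-const n 0) (ℕₚ.*-zeroʳ n))

  ⌊⌋-true : ∀ {a} {A : Set a} (a? : Dec A) → A → ⌊ a? ⌋ ≡ true
  ⌊⌋-true a? a = Equivalence.to T-≡ (fromWitness a)

  ⌊⌋-false : ∀ {a} {A : Set a} (a? : Dec A) → ¬ A → ⌊ a? ⌋ ≡ false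
  ⌊⌋-false a? ¬a = Equivalence.to T-not-≡ (fromWitnessFalse ¬a)

  T-not-∧ : ∀ {a b} {A : Set a} {B : Set b} (a? : Dec A) (b? : Dec B) →
    T (not (⌊ a? ⌋ ∧ ⌊ b? ⌋)) ⇔ (A → ¬ B)
  T-not-∧ (yes a) (yes b) = mk⇔ (λ ()) (λ ¬ab → ¬ab a b)
  T-not-∧ (yes _) (no ¬b) = mk⇔ (λ _ _ → ¬b) _
  T-not-∧ (no ¬a) _       = mk⇔ (λ _ a → contradiction a ¬a) _

  T-all-allFin : ∀ {n} (p : Fin n → Bool) → T (all p (allFin n)) ⇔ (∀ i → T (p i))
  T-all-allFin {n} p = mk⇔ (λ t → tabulate⁻ (all⁺ p (allFin n) t)) (λ t → all⁻ p (tabulate⁺ t))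

  ∑-swap-count : ∀ {n m} (P : Fin n → Bool) (X Y : Fin n → Fin m → Bool) →
    ∑ n (λ b → if P b then count m (λ a → X b a ∧ Y b a) else 0) ≡
    ∑ m (λ a → count n (λ b → P b ∧ Y b a ∧ X b a))
  ∑-swap-count {n} {m} P X Y =
    trans (∑-cong n (λ b → trans (if-∑ (P b) m _) (∑-cong m (indicator b))))
          (∑-comm (λ b a → 𝟙 (P b ∧ Y b a ∧ X b a)))
    where
    indicator : ∀ b a → (if P b then 𝟙 (X b a ∧ Y b a) else 0) ≡ 𝟙 (P b ∧ Y b a ∧ X b a)
    indicator b a = trans (sym (if-∧ (P b))) (cong (λ z → 𝟙 (P b ∧ z)) (∧-comm (X b a) (Y b a)))

  ∑-fibres : ∀ {n k} (W : Fin n → Fin k) (R : Fin k → Bool) (S : Fin n → Bool) →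
    ∑ k (λ c → if R c then count n (λ a → ⌊ W a ≟ c ⌋ ∧ S a) else 0) ≡ count n (λ a → R (W a) ∧ S a)
  ∑-fibres {n} {k} W R S = begin
    ∑ k (λ c → if R c then count n (λ a → ⌊ W a ≟ c ⌋ ∧ S a) else 0)
      ≡⟨ ∑-cong k (λ c → if-∑ (R c) n _) ⟩
    ∑ k (λ c → ∑ n (λ a → term a c))
      ≡⟨ ∑-comm (λ c a → term a c) ⟩
    ∑ n (λ a → ∑ k (term a))
      ≡⟨ ∑-cong n (λ a → ∑-single (term a) (W a) (off-fibre a)) ⟩
    ∑ n (λ a → term a (W a))
      ≡⟨ ∑-cong n on-fibre ⟩
    count n (λ a → R (W a) ∧ S a) ∎
    where
    term : Fin n → Fin k → ℕ
    term a c = if R c then 𝟙 (⌊ W a ≟ c ⌋ ∧ S a) else 0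

    off-fibre : ∀ a c → c ≢ W a → term a c ≡ 0
    off-fibre a c c≢Wa rewrite ⌊⌋-false (W a ≟ c) (c≢Wa ∘ sym) = if-eta (R c)

    on-fibre : ∀ a → term a (W a) ≡ 𝟙 (R (W a) ∧ S a)
    on-fibre a rewrite ⌊⌋-true (W a ≟ W a) refl = sym (if-∧ (R (W a)))

  module _ {n ℓ p} {_≺_ : Rel (Fin n) ℓ} (_≺?_ : B.Decidable _≺_) {P : Pred (Fin n) p} (P? : U.Decidable P) where

    ∃-minimal : ∀ {i} → Acc _≺_ i → P i → ∃ λ m → P m × (∀ {j} → j ≺ m → ¬ P j)
    ∃-minimal {i} (acc rs) Pi with any? (λ j → (j ≺? i) ×-dec P? j)
    ... | yes (j , j≺i , Pj) = ∃-minimal (rs j≺i) Pj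
    ... | no ∄               = i , Pi , λ j≺i Pj → ∄ (_ , j≺i , Pj)

  module FibreMinima {n k ℓ} {_≺_ : Rel (Fin n) ℓ} (_≺?_ : B.Decidable _≺_)
    (≺-wellFounded : WellFounded _≺_) (≺-cmp : Trichotomous _≡_ _≺_) (W : Fin n → Fin k) where

    isMinimal : Fin n → Bool
    isMinimal j = all (λ i → not (⌊ i ≺? j ⌋ ∧ ⌊ W i ≟ W j ⌋)) (allFin n)

    T-isMinimal : ∀ {j} → T (isMinimal j) ⇔ (∀ {i} → i ≺ j → W i ≢ W j)
    T-isMinimal {j} = mk⇔
      (λ t {i} → Equivalence.to (T-not-∧ (i ≺? j) (W i ≟ W j)) (Equivalence.to (T-all-allFin _) t i))
      (λ h → Equivalence.from (T-all-allFin _) (λ i → Equivalence.from (T-not-∧ (i ≺? j) (W i ≟ W j)) h))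

    minimal-unique : ∀ {j j′} → T (isMinimal j) → T (isMinimal j′) → W j ≡ W j′ → j ≡ j′
    minimal-unique {j} {j′} min-j min-j′ Wj≡Wj′ with ≺-cmp j j′
    ... | tri< j≺j′ _ _ = contradiction Wj≡Wj′ (Equivalence.to T-isMinimal min-j′ j≺j′)
    ... | tri≈ _ j≡j′ _ = j≡j′
    ... | tri> _ _ j′≺j = contradiction (sym Wj≡Wj′) (Equivalence.to T-isMinimal min-j j′≺j)

    minimal-exists : ∀ {i c} → W i ≡ c → ∃ λ j → T (isMinimal j) × W j ≡ c
    minimal-exists {i} {c} Wi≡c with ∃-minimal _≺?_ (λ j → W j ≟ c) (≺-wellFounded i) Wi≡c
    ... | j , Wj≡c , below =
      j , Equivalence.from T-isMinimal (λ i≺j Wi≡Wj → below i≺j (trans Wi≡Wj Wj≡c)) , Wj≡c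

    count-minimal-in-fibre : ∀ {i c} → W i ≡ c → count n (λ a → ⌊ W a ≟ c ⌋ ∧ isMinimal a) ≡ 1
    count-minimal-in-fibre {c = c} Wi≡c with minimal-exists Wi≡c
    ... | j , min-j , Wj≡c =
      trans (∑-single _ j outside) (𝟙-true (Equivalence.from T-∧ (fromWitness Wj≡c , min-j)))
      where
      outside : ∀ a → a ≢ j → 𝟙 (⌊ W a ≟ c ⌋ ∧ isMinimal a) ≡ 0
      outside a a≢j = 𝟙-false λ t → let Wa≡c , min-a = Equivalence.to T-∧ t in
        a≢j (minimal-unique min-a min-j (trans (toWitness Wa≡c) (sym Wj≡c)))

    count-minimal : (∀ c → ∃ λ i → W i ≡ c) → (g : Fin k → Bool) →
      count n (λ a → g (W a) ∧ isMinimal a) ≡ count k g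
    count-minimal surjective g = begin
      count n (λ a → g (W a) ∧ isMinimal a)
        ≡⟨ ∑-fibres W g isMinimal ⟨
      ∑ k (λ c → if g c then count n (λ a → ⌊ W a ≟ c ⌋ ∧ isMinimal a) else 0)
        ≡⟨ ∑-cong k in-fibre ⟩
      count k g ∎
      where
      in-fibre : ∀ c → (if g c then count n (λ a → ⌊ W a ≟ c ⌋ ∧ isMinimal a) else 0) ≡ 𝟙 (g c)
      in-fibre c = cong (if g c then_else 0) (count-minimal-in-fibre (proj₂ (surjective c)))

  T-<?-irrefl : ∀ {m} (x : Fin m) → ¬ T ⌊ x <? x ⌋
  T-<?-irrefl x t = <-irrefl refl (toWitness t)

  <?-flip : ∀ {m} {i j : Fin m} → j ≢ i → ⌊ j <? i ⌋ ≡ not ⌊ i <? j ⌋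
  <?-flip {i = i} {j} j≢i with <-cmp j i
  ... | tri< j<i _ i≮j rewrite ⌊⌋-true (j <? i) j<i | ⌊⌋-false (i <? j) i≮j = refl
  ... | tri≈ _ j≡i _   = contradiction j≡i j≢i
  ... | tri> j≮i _ i<j rewrite ⌊⌋-false (j <? i) j≮i | ⌊⌋-true (i <? j) i<j = refl

  𝟙-split : ∀ s x y q → (T q → x ≡ not y) → 𝟙 (s ∧ x ∧ q) + 𝟙 (s ∧ y ∧ q) ≡ 𝟙 (s ∧ q)
  𝟙-split false _ _ _     _ = refl
  𝟙-split true  x y false _ rewrite ∧-zeroʳ x | ∧-zeroʳ y = refl
  𝟙-split true  x y true  x≡¬y rewrite ∧-identityʳ x | ∧-identityʳ y | x≡¬y _ with y
  ... | false = refl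
  ... | true  = refl

  count-before+after : ∀ {n} (S Q : Fin n → Bool) (i : Fin n) → ¬ T (Q i) →
    count n (λ j → S j ∧ ⌊ j <? i ⌋ ∧ Q j) + count n (λ j → S j ∧ ⌊ i <? j ⌋ ∧ Q j) ≡
    count n (λ j → Q j ∧ S j)
  count-before+after {n} S Q i ¬Qi =
    trans (sym (∑-distrib-+ (λ j → 𝟙 (S j ∧ ⌊ j <? i ⌋ ∧ Q j)) (λ j → 𝟙 (S j ∧ ⌊ i <? j ⌋ ∧ Q j))))
          (∑-cong n split)
    where
    split : ∀ j → 𝟙 (S j ∧ ⌊ j <? i ⌋ ∧ Q j) + 𝟙 (S j ∧ ⌊ i <? j ⌋ ∧ Q j) ≡ 𝟙 (Q j ∧ S j)
    split j = trans (𝟙-split (S j) _ _ (Q j) (λ Qj → <?-flip λ { refl → ¬Qi Qj })) (cong 𝟙 (∧-comm (S j) (Q j)))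

  count-above+below : ∀ {k} (c : Fin k) → count k (λ b → ⌊ c <? b ⌋) + count k (λ b → ⌊ b <? c ⌋) ≡ k ∸ 1
  count-above+below {k} c = begin
    above + below
      ≡⟨ ℕₚ.m+n∸n≡m (above + below) 1 ⟨
    above + below + 1 ∸ 1
      ≡⟨ cong (λ x → above + below + x ∸ 1) count-≡c ⟨
    above + below + count k (λ b → ⌊ b ≟ c ⌋) ∸ 1
      ≡⟨ cong (_∸ 1) ∑-distrib-+₃ ⟨
    ∑ k (λ b → 𝟙 ⌊ c <? b ⌋ + 𝟙 ⌊ b <? c ⌋ + 𝟙 ⌊ b ≟ c ⌋) ∸ 1
      ≡⟨ cong (_∸ 1) (∑-cong k trichotomy) ⟩
    ∑ k (λ _ → 1) ∸ 1
      ≡⟨ cong (_∸ 1) (trans (∑-const k 1) (ℕₚ.*-identityʳ k)) ⟩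
    k ∸ 1 ∎
    where
    above below : ℕ
    above = count k (λ b → ⌊ c <? b ⌋)
    below = count k (λ b → ⌊ b <? c ⌋)

    ∑-distrib-+₃ : ∑ k (λ b → 𝟙 ⌊ c <? b ⌋ + 𝟙 ⌊ b <? c ⌋ + 𝟙 ⌊ b ≟ c ⌋) ≡
                   above + below + count k (λ b → ⌊ b ≟ c ⌋)
    ∑-distrib-+₃ =
      trans (∑-distrib-+ {k} (λ b → 𝟙 ⌊ c <? b ⌋ + 𝟙 ⌊ b <? c ⌋) (λ b → 𝟙 ⌊ b ≟ c ⌋))
            (cong (_+ count k (λ b → ⌊ b ≟ c ⌋)) (∑-distrib-+ {k} (λ b → 𝟙 ⌊ c <? b ⌋) (λ b → 𝟙 ⌊ b <? c ⌋)))

    count-≡c : count k (λ b → ⌊ b ≟ c ⌋) ≡ 1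
    count-≡c =
      trans (∑-single _ c (λ b b≢c → cong 𝟙 (⌊⌋-false (b ≟ c) b≢c))) (cong 𝟙 (⌊⌋-true (c ≟ c) refl))

    trichotomy : ∀ b → 𝟙 ⌊ c <? b ⌋ + 𝟙 ⌊ b <? c ⌋ + 𝟙 ⌊ b ≟ c ⌋ ≡ 1
    trichotomy b with <-cmp b c
    ... | tri< b<c b≢c c≮b
      rewrite ⌊⌋-false (c <? b) c≮b | ⌊⌋-true  (b <? c) b<c | ⌊⌋-false (b ≟ c) b≢c = refl
    ... | tri≈ b≮c b≡c c≮b
      rewrite ⌊⌋-false (c <? b) c≮b | ⌊⌋-false (b <? c) b≮c | ⌊⌋-true  (b ≟ c) b≡c = refl
    ... | tri> b≮c b≢c c<b
      rewrite ⌊⌋-true  (c <? b) c<b | ⌊⌋-false (b <? c) b≮c | ⌊⌋-false (b ≟ c) b≢c = refl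

  module Statistics {n k} (π : SetPartition n k) where

    private
      W : Fin n → Fin k
      W = w π

    -- Openers.isMinimal is isOpener π and Closers.isMinimal is isCloser π, by definition.
    module Openers = FibreMinima _<?_ <-wellFounded <-cmp W
    module Closers = FibreMinima (λ i j → j <? i) >-wellFounded (Flip.compare _<_ <-cmp) W

    count-openers : (g : Fin k → Bool) → count n (λ a → g (W a) ∧ isOpener π a) ≡ count k g
    count-openers = Openers.count-minimal (nonempty π)

    count-closers : (g : Fin k → Bool) → count n (λ a → g (W a) ∧ isCloser π a) ≡ count k g
    count-closers = Closers.count-minimal (nonempty π)

    opener-precedes : ∀ {i j} → T (isOpener π j) → W j < W i → j < i
    opener-precedes {i} {j} opener Wj<Wi with ordered π i (W j) Wj<Wi
    ... | m , m<i , Wm≡Wj =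
      ℕₚ.≤-<-trans (ℕₚ.≮⇒≥ λ m<j → Equivalence.to Openers.T-isMinimal opener m<j Wm≡Wj) m<i

    ros+rob : ∀ i → ros-at π i + rob-at π i ≡ count k (λ b → ⌊ W i <? b ⌋)
    ros+rob i = trans (count-before+after (isOpener π) _ i (T-<?-irrefl (W i))) (count-openers _)

    lcs+lcb : ∀ i → lcs-at π i + lcb-at π i ≡ count k (λ b → ⌊ b <? W i ⌋)
    lcs+lcb i = trans (count-before+after (isCloser π) _ i (T-<?-irrefl (W i))) (count-closers _)

    rcs+rcb : ∀ i → rcs-at π i + rcb-at π i ≡ count k (λ b → ⌊ W i <? b ⌋)
    rcs+rcb i = trans (count-before+after (isCloser π) _ i (T-<?-irrefl (W i))) (count-closers _)

    los+lob : ∀ i → los-at π i + lob-at π i ≡ count k (λ b → ⌊ b <? W i ⌋)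
    los+lob i = trans (count-before+after (isOpener π) _ i (T-<?-irrefl (W i))) (count-openers _)

    lob-at≡0 : ∀ i → lob-at π i ≡ 0
    lob-at≡0 i = count-none never
      where
      never : ∀ j → ¬ T (isOpener π j ∧ ⌊ i <? j ⌋ ∧ ⌊ W j <? W i ⌋)
      never j t with Equivalence.to (T-∧ {isOpener π j}) t
      ... | opener , rest with Equivalence.to (T-∧ {⌊ i <? j ⌋}) rest
      ... | i<j , Wj<Wi = <-asym (toWitness i<j) (opener-precedes opener (toWitness Wj<Wi))

    ros+rob+lcs+lcb : (ros π + rob π) + (lcs π + lcb π) ≡ n * (k ∸ 1)
    ros+rob+lcs+lcb = begin
      (ros π + rob π) + (lcs π + lcb π)
        ≡⟨ ∑-distrib-+₄ (ros-at π) (rob-at π) (lcs-at π) (lcb-at π) ⟨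
      ∑ n (λ i → (ros-at π i + rob-at π i) + (lcs-at π i + lcb-at π i))
        ≡⟨ ∑-cong n other-blocks ⟩
      ∑ n (λ _ → k ∸ 1)
        ≡⟨ ∑-const n (k ∸ 1) ⟩
      n * (k ∸ 1) ∎
      where
      other-blocks : ∀ i → (ros-at π i + rob-at π i) + (lcs-at π i + lcb-at π i) ≡ k ∸ 1
      other-blocks i = trans (cong₂ _+_ (ros+rob i) (lcs+lcb i)) (count-above+below (W i))

    rcs+rcb+los+lob : (rcs π + rcb π) + (los π + lob π) ≡ n * (k ∸ 1)
    rcs+rcb+los+lob = begin
      (rcs π + rcb π) + (los π + lob π)
        ≡⟨ ∑-distrib-+₄ (rcs-at π) (rcb-at π) (los-at π) (lob-at π) ⟨
      ∑ n (λ i → (rcs-at π i + rcb-at π i) + (los-at π i + lob-at π i))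
        ≡⟨ ∑-cong n other-blocks ⟩
      ∑ n (λ _ → k ∸ 1)
        ≡⟨ ∑-const n (k ∸ 1) ⟩
      n * (k ∸ 1) ∎
      where
      other-blocks : ∀ i → (rcs-at π i + rcb-at π i) + (los-at π i + lob-at π i) ≡ k ∸ 1
      other-blocks i = trans (cong₂ _+_ (rcs+rcb i) (los+lob i)) (count-above+below (W i))

    los≡lcs+lcb : los π ≡ lcs π + lcb π
    los≡lcs+lcb = trans (∑-cong n at) (∑-distrib-+ (lcs-at π) (lcb-at π))
      where
      at : ∀ i → los-at π i ≡ lcs-at π i + lcb-at π i
      at i = begin
        los-at π i                    ≡⟨ ℕₚ.+-identityʳ _ ⟨
        los-at π i + 0                ≡⟨ cong (los-at π i +_) (lob-at≡0 i) ⟨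
        los-at π i + lob-at π i       ≡⟨ los+lob i ⟩
        count k (λ b → ⌊ b <? W i ⌋)  ≡⟨ lcs+lcb i ⟨
        lcs-at π i + lcb-at π i       ∎

    ∑-linv : (P : Fin n → Bool) →
      ∑ n (λ b → if P b then linv π b else 0) ≡
      ∑ n (λ a → count n (λ b → P b ∧ ⌊ b <? a ⌋ ∧ ⌊ W a <? W b ⌋))
    ∑-linv P =
      trans (∑-cong n (λ b → cong (if P b then_else 0) (∑-fibres W (λ c → ⌊ c <? W b ⌋) (λ a → ⌊ b <? a ⌋))))
            (∑-swap-count P (λ b a → ⌊ W a <? W b ⌋) (λ b a → ⌊ b <? a ⌋))

    ∑-rinv : (P : Fin n → Bool) →
      ∑ n (λ b → if P b then rinv π b else 0) ≡
      ∑ n (λ a → count n (λ b → P b ∧ ⌊ a <? b ⌋ ∧ ⌊ W b <? W a ⌋))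
    ∑-rinv P =
      trans (∑-cong n (λ b → cong (if P b then_else 0) (∑-fibres W (λ c → ⌊ W b <? c ⌋) (λ a → ⌊ a <? b ⌋))))
            (∑-swap-count P (λ b a → ⌊ W b <? W a ⌋) (λ b a → ⌊ a <? b ⌋))

    linv-O≡ros : linv-O π ≡ ros π
    linv-O≡ros = ∑-linv (isOpener π)

    linv-F≡rcs : linv-F π ≡ rcs π
    linv-F≡rcs = ∑-linv (isCloser π)

    rinv-F≡lcb : rinv-F π ≡ lcb π
    rinv-F≡lcb = ∑-rinv (isCloser π)

open Counting using (module Statistics)
open import Data.Integer using (_+_; _-_; +_; -_; _⊖_)
open import Data.Integer.Properties using (pos-+; neg-distrib-+; +-assoc; [+m]-[+n]≡m⊖n; ⊖-≥)

+[m+n]-+n≡+m : ∀ m n → + (m ℕ.+ n) - + n ≡ + m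
+[m+n]-+n≡+m m n = begin
  + (m ℕ.+ n) - + n  ≡⟨ [+m]-[+n]≡m⊖n (m ℕ.+ n) n ⟩
  (m ℕ.+ n) ⊖ n      ≡⟨ ⊖-≥ (ℕₚ.m≤n+m n m) ⟩
  + (m ℕ.+ n ∸ n)    ≡⟨ cong +_ (ℕₚ.m+n∸n≡m m n) ⟩
  + m                ∎

m+n≡o⇒+m≡+o-+n : ∀ {m n o} → m ℕ.+ n ≡ o → + m ≡ + o - + n
m+n≡o⇒+m≡+o-+n {m} {n} refl = sym (+[m+n]-+n≡+m m n)

proposition1 : ∀ (n k : ℕ) (π : SetPartition n k) →
    ((mak π ≡ lmak' π) × (lmak' π ≡ + los π - + rinv-F π + + linv-O π))
    × ((mak' π ≡ lmak π) × (lmak π ≡ nk-1 π - + los π - + linv-F π))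
proposition1 n k π = (mak≡lmak' , lmak'≡los-rinv-F+linv-O) , (mak'≡lmak , lmak≡nk-1-los-linv-F)
  where
  open Statistics π

  mak≡lmak' : mak π ≡ lmak' π
  mak≡lmak' = m+n≡o⇒+m≡+o-+n (trans (regroup (ros π) (rob π) (lcs π) (lcb π)) ros+rob+lcs+lcb)
    where
    regroup : ∀ a b c d → (a ℕ.+ c) ℕ.+ (d ℕ.+ b) ≡ (a ℕ.+ b) ℕ.+ (c ℕ.+ d)
    regroup = solve-∀

  lmak'≡los-rinv-F+linv-O : lmak' π ≡ + los π - + rinv-F π + + linv-O π
  lmak'≡los-rinv-F+linv-O = begin
    lmak' π                                     ≡⟨ mak≡lmak' ⟨
    + (ros π ℕ.+ lcs π)                         ≡⟨ cong +_ (ℕₚ.+-comm (ros π) (lcs π)) ⟩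
    + (lcs π ℕ.+ ros π)                         ≡⟨ pos-+ (lcs π) (ros π) ⟩
    + lcs π + + ros π                           ≡⟨ cong₂ _+_ (+[m+n]-+n≡+m (lcs π) (lcb π)) (cong +_ linv-O≡ros) ⟨
    + (lcs π ℕ.+ lcb π) - + lcb π + + linv-O π  ≡⟨ cong₂ (λ a b → + a - + b + + linv-O π) los≡lcs+lcb rinv-F≡lcb ⟨
    + los π - + rinv-F π + + linv-O π           ∎

  mak'≡lmak : mak' π ≡ lmak π
  mak'≡lmak = m+n≡o⇒+m≡+o-+n (trans (regroup (rcs π) (rcb π) (los π) (lob π)) rcs+rcb+los+lob)
    where
    regroup : ∀ a b c d → (d ℕ.+ b) ℕ.+ (c ℕ.+ a) ≡ (a ℕ.+ b) ℕ.+ (c ℕ.+ d)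
    regroup = solve-∀

  lmak≡nk-1-los-linv-F : lmak π ≡ nk-1 π - + los π - + linv-F π
  lmak≡nk-1-los-linv-F = begin
    nk-1 π - + (los π ℕ.+ rcs π)        ≡⟨ cong (λ x → nk-1 π - x) (pos-+ (los π) (rcs π)) ⟩
    nk-1 π - (+ los π + + rcs π)        ≡⟨ cong (_+_ (nk-1 π)) (neg-distrib-+ (+ los π) (+ rcs π)) ⟩
    nk-1 π + (- + los π + - + rcs π)    ≡⟨ +-assoc (nk-1 π) (- + los π) (- + rcs π) ⟨
    nk-1 π - + los π - + rcs π          ≡⟨ cong (λ x → nk-1 π - + los π - + x) linv-F≡rcs ⟨
    nk-1 π - + los π - + linv-F π       ∎
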